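{- Let $N=2r$ be even. For $1\le k\le r-1$, and also for $k=r$ when $4\mid N$, we have $\rho^{ -1}\,\mu_1\big(B_{N,2}^{(k,1)}\big)\,\rho=B_{N,2}^{(k,2)}$.
   Context: Skew-symmetric $N\times N$ integer matrices correspond to quivers. Mutation at $k$: $\mu_kB=\tilde B$ with $\tilde b_{ij}=-b_{ij}$ if $i=k$ or $j=k$, and $\tilde b_{ij}=b_{ij}+\frac12(|b_{ik}|b_{kj}+b_{ik}|b_{kj}|)$ otherwise. $\rho$ is the permutation matrix with $\rho_{i+1,i}=1$ ($1\le i\le N-1$), $\rho_{1,N}=1$, other entries $0$. $\tau$ is the matrix with $\tau_{i+1,i}=1$ ($1\le i\le N-1$), $\tau_{1,N}=-1$, other entries $0$. For $1\le k\le r$, $R_N^{(k)}$ is the skew-symmetric matrix with $(R_N^{(k)})_{N-k+1,1}=1$, $(R_N^{(k)})_{1,N-k+1}=-1$, all other entries $0$. For $1\le k\le r-1$, $B_{N,2}^{(k,1)}=\sum_{i=0}^{r-1}\tau^{2i}R_N^{(k)}\tau^{ -2i}$; if $4\mid N$, $B_{N,2}^{(r,1)}=\sum_{i=0}^{r/2-1}\tau^{2i}R_N^{(r)}\tau^{ -2i}$. In each case $B_{N,2}^{(k,2)}=\tau B_{N,2}^{(k,1)}\tau^{ -1}$. -}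

module Defs where

open import Data.Nat as ℕ using (ℕ; zero; suc; _<ᵇ_; _≡ᵇ_)
open import Data.Nat.DivMod using (_/_)
open import Data.Integer as ℤ using (ℤ; +_; -_; ∣_∣; _/ℕ_)
open import Data.Fin using (Fin; toℕ)
open import Data.Bool using (Bool; true; false; if_then_else_; _∧_; _∨_)
open import Relation.Binary.PropositionalEquality using (_≡_)

-- Integer N×N matrices, indexed 0-based by Fin N
-- (paper index i corresponds to Fin element with toℕ = i - 1).
Mat : ℕ → Set
Mat n = Fin n → Fin n → ℤ

infix 4 _≡ᴹ_
_≡ᴹ_ : ∀ {n} → Mat n → Mat n → Set
A ≡ᴹ B = ∀ i j → A i j ≡ B i j

sumFin : ∀ {n} → (Fin n → ℤ) → ℤ
sumFin {zero} f = + 0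
sumFin {suc n} f = f Fin.zero ℤ.+ sumFin (λ i → f (Fin.suc i))

infixl 7 _·_
_·_ : ∀ {n} → Mat n → Mat n → Mat n
(A · B) i j = sumFin (λ l → A i l ℤ.* B l j)

I : ∀ {n} → Mat n
I i j = if toℕ i ≡ᵇ toℕ j then + 1 else + 0

_⊕_ : ∀ {n} → Mat n → Mat n → Mat n
(A ⊕ B) i j = A i j ℤ.+ B i j

O : ∀ {n} → Mat n
O i j = + 0

transpose : ∀ {n} → Mat n → Mat n
transpose A i j = A j i

_^ᴹ_ : ∀ {n} → Mat n → ℕ → Mat n
A ^ᴹ zero = I
A ^ᴹ suc m = A · (A ^ᴹ m)

sumMat : ∀ {n} → ℕ → (ℕ → Mat n) → Mat n
sumMat zero f = O
sumMat (suc m) f = sumMat m f ⊕ f m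

ρ : ∀ {n} → Mat n
ρ {n} a b =
  if (toℕ a ≡ᵇ suc (toℕ b)) then + 1
  else if ((toℕ a ≡ᵇ 0) ∧ (suc (toℕ b) ≡ᵇ n)) then + 1 else + 0

τ : ∀ {n} → Mat n
τ {n} a b =
  if (toℕ a ≡ᵇ suc (toℕ b)) then + 1
  else if ((toℕ a ≡ᵇ 0) ∧ (suc (toℕ b) ≡ᵇ n)) then - (+ 1) else + 0

-- ρ and τ are signed permutation matrices, hence orthogonal:
-- their inverses are their transposes.
ρ⁻¹ : ∀ {n} → Mat n
ρ⁻¹ = transpose ρ

τ⁻¹ : ∀ {n} → Mat n
τ⁻¹ = transpose τ

-- R_N^{(k)} : entry (N-k+1, 1) = 1, (1, N-k+1) = -1 (1-based);
-- 0-based: (N-k, 0) = 1, (0, N-k) = -1.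
R : (n k : ℕ) → Mat n
R n k a b =
  if ((toℕ a ≡ᵇ (n ℕ.∸ k)) ∧ (toℕ b ≡ᵇ 0)) then + 1
  else if ((toℕ a ≡ᵇ 0) ∧ (toℕ b ≡ᵇ (n ℕ.∸ k))) then - (+ 1) else + 0

orbitSum : (n k m : ℕ) → Mat n
orbitSum n k m = sumMat m (λ i → ((τ ^ᴹ (2 ℕ.* i)) · R n k) · (τ⁻¹ ^ᴹ (2 ℕ.* i)))

B1 : (r k : ℕ) → Mat (2 ℕ.* r)
B1 r k = orbitSum (2 ℕ.* r) k (if k <ᵇ r then r else r / 2)

B2 : (r k : ℕ) → Mat (2 ℕ.* r)
B2 r k = (τ · B1 r k) · τ⁻¹

μ : ∀ {n} → Fin n → Mat n → Mat n
μ {n} k B i j =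
  if ((toℕ i ≡ᵇ toℕ k) ∨ (toℕ j ≡ᵇ toℕ k)) then - B i j
  else B i j ℤ.+ (((+ ∣ B i k ∣) ℤ.* B k j ℤ.+ B i k ℤ.* (+ ∣ B k j ∣)) /ℕ 2)

-- Index the vertices 0, …, N-1 (vertex 1 of the paper is 0).  τ sends eₓ to eₓ₊₁, except that
-- e_{N-1} goes to -e₀, so τᶜ R τ⁻ᶜ is the wedge (τᶜ eₚ) ∧ e_c with p = N - k.  B = B^{(k,1)} sums
-- every other term of this orbit, and conjugation by τ² permutes its terms cyclically: the orbit
-- closes up after N steps (τᴺ = -1), and for k = N/2 already after k steps.  Hence τ²Bτ⁻² = B.
-- Every term has a nonnegative column 0, so vertex 0 is a sink and μ₀ only negates row and
-- column 0: μ₀B = DBD with D = diag(-1, 1, …, 1).  Entrywise ρ⁻¹(DBD)ρ at (x, y) is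
-- (DBD)(x+1, y+1), while τBτ⁻¹ at (x, y) is εₓε_y B(x-1, y-1) with the same signs as D; these agree
-- by τ²-invariance of B.

module Submission where

open import Defs

-- Integer arithmetic is opened only inside this block, so that the theorem at the end can use
-- the operators of ℕ.
module _ where
  open import Data.Nat as ℕ using (ℕ; zero; suc; _≡ᵇ_; _≤_; _<_; _∸_)
  import Data.Nat.Properties as ℕ
  open import Data.Integer as ℤ using (ℤ; +_; -_; _+_; _-_; _*_; ∣_∣; _/ℕ_)
  import Data.Integer.Properties as ℤ
  open import Data.Integer.Tactic.RingSolver using (solve-∀)
  open import Algebra.Properties.Semiring.Sum ℤ.+-*-semiring
    using (sum; ∑-comm; *-distribˡ-sum; *-distribʳ-sum)
  open import Data.Fin using (Fin; zero; suc; toℕ; fromℕ<)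
  open import Data.Fin.Properties using (toℕ-fromℕ<; toℕ<n)
  open import Data.Bool as Bool using (Bool; true; false; if_then_else_; T)
  open import Data.Bool.Properties using (T-∧)
  open import Data.Unit using (tt)
  open import Data.Empty using (⊥; ⊥-elim)
  open import Data.Product using (proj₁)
  open import Relation.Nullary using (yes; no)
  open import Function using (_∘_; Equivalence)
  open import Relation.Binary.Bundles using (Setoid)
  open import Relation.Binary.PropositionalEquality
  import Relation.Binary.Reasoning.Setoid as SetoidReasoning

  ⟦_⟧ : Bool → ℤ
  ⟦ b ⟧ = if b then + 1 else + 0

  δ : ℕ → ℕ → ℤ
  δ m n = ⟦ m ≡ᵇ n ⟧

  δ-≡ : ∀ {m n} → m ≡ n → δ m n ≡ + 1
  δ-≡ {zero} refl = refl
  δ-≡ {suc m} refl = δ-≡ {m} refl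

  δ-≢ : ∀ {m n} → m ≢ n → δ m n ≡ + 0
  δ-≢ {zero} {zero} m≢n = ⊥-elim (m≢n refl)
  δ-≢ {zero} {suc n} _ = refl
  δ-≢ {suc m} {zero} _ = refl
  δ-≢ {suc m} {suc n} m≢n = δ-≢ (m≢n ∘ cong suc)

  δ-comm : ∀ m n → δ m n ≡ δ n m
  δ-comm zero zero = refl
  δ-comm zero (suc n) = refl
  δ-comm (suc m) zero = refl
  δ-comm (suc m) (suc n) = δ-comm m n

  δ-cong : ∀ {m n m′ n′} → (m ≡ n → m′ ≡ n′) → (m′ ≡ n′ → m ≡ n) → δ m n ≡ δ m′ n′
  δ-cong {m} {n} to from with m ℕ.≟ n
  ... | yes m≡n = trans (δ-≡ m≡n) (sym (δ-≡ (to m≡n)))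
  ... | no m≢n = trans (δ-≢ m≢n) (sym (δ-≢ (m≢n ∘ from)))

  0≤δ : ∀ m n → + 0 ℤ.≤ δ m n
  0≤δ m n with m ≡ᵇ n
  ... | true = ℤ.+≤+ ℕ.z≤n
  ... | false = ℤ.+≤+ ℕ.z≤n

  0≤δ*δ : ∀ m n m′ n′ → + 0 ℤ.≤ δ m n * δ m′ n′
  0≤δ*δ m n m′ n′ with m ≡ᵇ n
  ... | true = subst (+ 0 ℤ.≤_) (sym (ℤ.*-identityˡ _)) (0≤δ m′ n′)
  ... | false = ℤ.+≤+ ℕ.z≤n

  ≡ᵇ⇒≡ : ∀ {m n} → (m ≡ᵇ n) ≡ true → m ≡ n
  ≡ᵇ⇒≡ {m} {n} eq = ℕ.≡ᵇ⇒≡ m n (subst T (sym eq) tt)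

  ≡ᵇ⇒≢ : ∀ {m n} → (m ≡ᵇ n) ≡ false → m ≢ n
  ≡ᵇ⇒≢ {m} {n} eq m≡n = subst T eq (ℕ.≡⇒≡ᵇ m n m≡n)

  if-cascade : ∀ b c → (T b → T c → ⊥) → (if b then + 1 else if c then - + 1 else + 0) ≡ ⟦ b ⟧ - ⟦ c ⟧
  if-cascade true true exclusive = ⊥-elim (exclusive tt tt)
  if-cascade true false _ = refl
  if-cascade false true _ = refl
  if-cascade false false _ = refl

  ⟦∧⟧ : ∀ b c → ⟦ b Bool.∧ c ⟧ ≡ ⟦ b ⟧ * ⟦ c ⟧
  ⟦∧⟧ true c = sym (ℤ.*-identityˡ ⟦ c ⟧)
  ⟦∧⟧ false c = refl

  -- Finite sums

  sumFin≡sum : ∀ {n} (f : Fin n → ℤ) → sumFin f ≡ sum f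
  sumFin≡sum {zero} f = refl
  sumFin≡sum {suc n} f = cong (λ s → f zero + s) (sumFin≡sum (f ∘ suc))

  sumFin-cong : ∀ {n} {f g : Fin n → ℤ} → (∀ i → f i ≡ g i) → sumFin f ≡ sumFin g
  sumFin-cong {zero} f≗g = refl
  sumFin-cong {suc n} f≗g = cong₂ _+_ (f≗g zero) (sumFin-cong (f≗g ∘ suc))

  sumFin-distribˡ : ∀ {n} a (f : Fin n → ℤ) → a * sumFin f ≡ sumFin (λ i → a * f i)
  sumFin-distribˡ a f = begin
    a * sumFin f          ≡⟨ cong (a *_) (sumFin≡sum f) ⟩
    a * sum f             ≡⟨ *-distribˡ-sum a f ⟩
    sum (λ i → a * f i)   ≡⟨ sumFin≡sum (λ i → a * f i) ⟨
    sumFin (λ i → a * f i) ∎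
    where open ≡-Reasoning

  sumFin-distribʳ : ∀ {n} a (f : Fin n → ℤ) → sumFin f * a ≡ sumFin (λ i → f i * a)
  sumFin-distribʳ a f = begin
    sumFin f * a           ≡⟨ cong (_* a) (sumFin≡sum f) ⟩
    sum f * a              ≡⟨ *-distribʳ-sum a f ⟩
    sum (λ i → f i * a)    ≡⟨ sumFin≡sum (λ i → f i * a) ⟨
    sumFin (λ i → f i * a) ∎
    where open ≡-Reasoning

  sumFin-comm : ∀ {m n} (f : Fin m → Fin n → ℤ) →
    sumFin (λ i → sumFin (f i)) ≡ sumFin (λ j → sumFin (λ i → f i j))
  sumFin-comm f = begin
    sumFin (λ i → sumFin (f i))            ≡⟨ sumFin-cong (λ i → sumFin≡sum (f i)) ⟩
    sumFin (λ i → sum (f i))               ≡⟨ sumFin≡sum (λ i → sum (f i)) ⟩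
    sum (λ i → sum (f i))                  ≡⟨ ∑-comm f ⟩
    sum (λ j → sum (λ i → f i j))          ≡⟨ sumFin≡sum (λ j → sum (λ i → f i j)) ⟨
    sumFin (λ j → sum (λ i → f i j))       ≡⟨ sumFin-cong (λ j → sumFin≡sum (λ i → f i j)) ⟨
    sumFin (λ j → sumFin (λ i → f i j))    ∎
    where open ≡-Reasoning

  sumFin-zero : ∀ {n} {f : Fin n → ℤ} → (∀ i → f i ≡ + 0) → sumFin f ≡ + 0
  sumFin-zero {zero} f≗0 = refl
  sumFin-zero {suc n} {f} f≗0 = cong₂ _+_ (f≗0 zero) (sumFin-zero {f = f ∘ suc} (f≗0 ∘ suc))

  sumFin-δ : ∀ {n} (f : Fin n → ℤ) (i : Fin n) → sumFin (λ l → δ (toℕ l) (toℕ i) * f l) ≡ f i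
  sumFin-δ f zero = trans (cong₂ _+_ (ℤ.*-identityˡ (f zero)) (sumFin-zero {f = λ l → δ (toℕ (suc l)) 0 * f (suc l)} (λ _ → refl))) (ℤ.+-identityʳ _)
  sumFin-δ f (suc i) = trans (ℤ.+-identityˡ _) (sumFin-δ (f ∘ suc) i)

  sumFin-pick : ∀ {n} {f : Fin n → ℤ} (g : ℕ → ℤ) {p} → p < n →
    (∀ l → f l ≡ δ (toℕ l) p * g (toℕ l)) → sumFin f ≡ g p
  sumFin-pick {n} {f} g {p} p<n f≗ = begin
    sumFin f                                       ≡⟨ sumFin-cong (λ l → trans (f≗ l) (cong (λ q → δ (toℕ l) q * g (toℕ l)) (sym (toℕ-fromℕ< p<n)))) ⟩
    sumFin {n} (λ l → δ (toℕ l) (toℕ i) * g (toℕ l)) ≡⟨ sumFin-δ (g ∘ toℕ) i ⟩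
    g (toℕ i)                                      ≡⟨ cong g (toℕ-fromℕ< p<n) ⟩
    g p                                            ∎
    where
    i : Fin n
    i = fromℕ< p<n
    open ≡-Reasoning

  sumTo : ℕ → (ℕ → ℤ) → ℤ
  sumTo zero h = + 0
  sumTo (suc m) h = sumTo m h + h m

  sumTo-cong : ∀ m {h h′ : ℕ → ℤ} → (∀ i → i < m → h i ≡ h′ i) → sumTo m h ≡ sumTo m h′
  sumTo-cong zero h≗h′ = refl
  sumTo-cong (suc m) h≗h′ = cong₂ _+_ (sumTo-cong m (λ i i<m → h≗h′ i (ℕ.m<n⇒m<1+n i<m))) (h≗h′ m (ℕ.n<1+n m))

  sumTo-rotate : ∀ m (h : ℕ → ℤ) → sumTo (suc m) h ≡ h 0 + sumTo m (h ∘ suc)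
  sumTo-rotate zero h = trans (ℤ.+-identityˡ (h 0)) (sym (ℤ.+-identityʳ (h 0)))
  sumTo-rotate (suc m) h = trans (cong (_+ h (suc m)) (sumTo-rotate m h)) (ℤ.+-assoc (h 0) _ _)

  sumTo-neg : ∀ m (h : ℕ → ℤ) → sumTo m (λ i → - h i) ≡ - sumTo m h
  sumTo-neg zero h = refl
  sumTo-neg (suc m) h = trans (cong (_+ - h m) (sumTo-neg m h)) (sym (ℤ.neg-distrib-+ (sumTo m h) (h m)))

  sumTo-sandwich : ∀ a b m (h : ℕ → ℤ) → a * sumTo m h * b ≡ sumTo m (λ i → a * h i * b)
  sumTo-sandwich a b zero h = trans (cong (_* b) (ℤ.*-zeroʳ a)) (ℤ.*-zeroˡ b)
  sumTo-sandwich a b (suc m) h = trans (distrib a b (sumTo m h) (h m)) (cong (_+ a * h m * b) (sumTo-sandwich a b m h))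
    where
    distrib : ∀ a b s t → a * (s + t) * b ≡ a * s * b + a * t * b
    distrib = solve-∀

  sumTo-nonneg : ∀ m {h : ℕ → ℤ} → (∀ i → + 0 ℤ.≤ h i) → + 0 ℤ.≤ sumTo m h
  sumTo-nonneg zero _ = ℤ.≤-refl
  sumTo-nonneg (suc m) 0≤h = ℤ.+-mono-≤ (sumTo-nonneg m 0≤h) (0≤h m)

  -- Matrix algebra

  module _ {n : ℕ} where

    ≡ᴹ-setoid : Setoid _ _
    ≡ᴹ-setoid = record
      { Carrier = Mat n
      ; _≈_ = _≡ᴹ_
      ; isEquivalence = record
        { refl = λ i j → refl
        ; sym = λ A≡B i j → sym (A≡B i j)
        ; trans = λ A≡B B≡C i j → trans (A≡B i j) (B≡C i j) } }

    ·-cong : {A A′ B B′ : Mat n} → A ≡ᴹ A′ → B ≡ᴹ B′ → A · B ≡ᴹ A′ · B′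
    ·-cong A≡A′ B≡B′ i j = sumFin-cong (λ l → cong₂ _*_ (A≡A′ i l) (B≡B′ l j))

    ·-assoc : (A B C : Mat n) → (A · B) · C ≡ᴹ A · (B · C)
    ·-assoc A B C i j = begin
      sumFin (λ l → sumFin (λ m → A i m * B m l) * C l j)    ≡⟨ sumFin-cong (λ l → sumFin-distribʳ (C l j) (λ m → A i m * B m l)) ⟩
      sumFin (λ l → sumFin (λ m → A i m * B m l * C l j))    ≡⟨ sumFin-comm (λ l m → A i m * B m l * C l j) ⟩
      sumFin (λ m → sumFin (λ l → A i m * B m l * C l j))    ≡⟨ sumFin-cong (λ m → sumFin-cong (λ l → ℤ.*-assoc (A i m) (B m l) (C l j))) ⟩
      sumFin (λ m → sumFin (λ l → A i m * (B m l * C l j)))  ≡⟨ sumFin-cong (λ m → sumFin-distribˡ (A i m) (λ l → B m l * C l j)) ⟨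
      sumFin (λ m → A i m * sumFin (λ l → B m l * C l j))    ∎
      where open ≡-Reasoning

    ·-identityˡ : (A : Mat n) → I · A ≡ᴹ A
    ·-identityˡ A i j = trans (sumFin-cong (λ l → cong (_* A l j) (δ-comm (toℕ i) (toℕ l)))) (sumFin-δ (λ l → A l j) i)

    ·-identityʳ : (A : Mat n) → A · I ≡ᴹ A
    ·-identityʳ A i j = trans (sumFin-cong (λ l → ℤ.*-comm (A i l) _)) (sumFin-δ (A i) j)

    ^ᴹ-comm : (A : Mat n) (m : ℕ) → A · (A ^ᴹ m) ≡ᴹ (A ^ᴹ m) · A
    ^ᴹ-comm A zero = λ i j → trans (·-identityʳ A i j) (sym (·-identityˡ A i j))
    ^ᴹ-comm A (suc m) = begin
      A · (A · A ^ᴹ m)   ≈⟨ ·-cong {A} (λ _ _ → refl) (^ᴹ-comm A m) ⟩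
      A · (A ^ᴹ m · A)   ≈⟨ ·-assoc A (A ^ᴹ m) A ⟨
      A · A ^ᴹ m · A     ∎
      where open SetoidReasoning ≡ᴹ-setoid

    conj-^ᴹ-suc : (P A Q : Mat n) (c : ℕ) →
      (P ^ᴹ suc c · A) · Q ^ᴹ suc c ≡ᴹ (P · ((P ^ᴹ c · A) · Q ^ᴹ c)) · Q
    conj-^ᴹ-suc P A Q c = begin
      (P · P ^ᴹ c · A) · (Q · Q ^ᴹ c)     ≈⟨ ·-cong (·-assoc P (P ^ᴹ c) A) (^ᴹ-comm Q c) ⟩
      (P · (P ^ᴹ c · A)) · (Q ^ᴹ c · Q)   ≈⟨ ·-assoc (P · (P ^ᴹ c · A)) (Q ^ᴹ c) Q ⟨
      (P · (P ^ᴹ c · A)) · Q ^ᴹ c · Q     ≈⟨ ·-cong (·-assoc P (P ^ᴹ c · A) (Q ^ᴹ c)) (λ _ _ → refl) ⟩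
      (P · ((P ^ᴹ c · A) · Q ^ᴹ c)) · Q   ∎
      where open SetoidReasoning ≡ᴹ-setoid

  ε : ℕ → ℤ
  ε zero = - + 1
  ε (suc _) = + 1

  μ-at-sink : ∀ {ν} (B : Mat (suc ν)) → (∀ i → + 0 ℤ.≤ B i zero) → (∀ j → B zero j ℤ.≤ + 0) →
    μ zero B ≡ᴹ λ i j → ε (toℕ i) * B i j * ε (toℕ j)
  μ-at-sink B col row zero zero rewrite ℤ.≤-antisym (row zero) (col zero) = refl
  μ-at-sink B col row zero (suc j) = negate-row (B zero (suc j))
    where
    negate-row : ∀ b → - b ≡ - + 1 * b * + 1
    negate-row = solve-∀
  μ-at-sink B col row (suc i) zero = negate-col (B (suc i) zero)
    where
    negate-col : ∀ b → - b ≡ + 1 * b * - + 1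
    negate-col = solve-∀
  μ-at-sink B col row (suc i) (suc j) = begin
    B (suc i) (suc j) + (+ ∣ a ∣ * b + a * + ∣ b ∣) /ℕ 2   ≡⟨ cong (λ t → B (suc i) (suc j) + t /ℕ 2) no-correction ⟩
    B (suc i) (suc j) + + 0                               ≡⟨ unchanged (B (suc i) (suc j)) ⟩
    + 1 * B (suc i) (suc j) * + 1                         ∎
    where
    open ≡-Reasoning
    a = B (suc i) zero
    b = B zero (suc j)
    cancel : ∀ a b → a * b + a * - b ≡ + 0
    cancel = solve-∀
    unchanged : ∀ c → c + + 0 ≡ + 1 * c * + 1
    unchanged = solve-∀
    no-correction : + ∣ a ∣ * b + a * + ∣ b ∣ ≡ + 0
    no-correction = begin
      + ∣ a ∣ * b + a * + ∣ b ∣    ≡⟨ cong₂ (λ s t → s * b + a * t) (ℤ.0≤i⇒+∣i∣≡i (col (suc i)))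
                                         (trans (cong +_ (sym (ℤ.∣-i∣≡∣i∣ b))) (ℤ.0≤i⇒+∣i∣≡i (ℤ.neg-mono-≤ (row (suc j))))) ⟩
      a * b + a * - b              ≡⟨ cancel a b ⟩
      + 0                          ∎

  ρ⁻¹μρ≡τBτ⁻¹ : ∀ {ν} → Mat (suc ν) → Set
  ρ⁻¹μρ≡τBτ⁻¹ B = (ρ⁻¹ · μ zero B) · ρ ≡ᴹ (τ · B) · τ⁻¹

  Entries : Set
  Entries = ℕ → ℕ → ℤ

  -- Matrices are handled through entry functions on ℕ; inside Cyclic these are compared on [0, n).
  infix 4 _has-entries_
  _has-entries_ : ∀ {n} → Mat n → Entries → Set
  A has-entries M = ∀ a b → A a b ≡ M (toℕ a) (toℕ b)

  has-entries-≡ᴹ : ∀ {n} {A B : Mat n} {M : Entries} → A ≡ᴹ B → B has-entries M → A has-entries M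
  has-entries-≡ᴹ A≡B B≗M a b = trans (A≡B a b) (B≗M a b)

  sumMat-entries : ∀ {n} m {f : ℕ → Mat n} {H : ℕ → Entries} → (∀ i → i < m → f i has-entries H i) →
    sumMat m f has-entries λ x y → sumTo m (λ i → H i x y)
  sumMat-entries zero _ a b = refl
  sumMat-entries (suc m) {H = H} f≗H a b =
    cong₂ _+_ (sumMat-entries m {H = H} (λ i i<m → f≗H i (ℕ.m<n⇒m<1+n i<m)) a b) (f≗H m (ℕ.n<1+n m) a b)

  infixr 7 _∧_
  _∧_ : (ℕ → ℤ) → (ℕ → ℤ) → Entries
  (u ∧ w) x y = u x * w y - w x * u y

  ∧-antisym : ∀ u w x y → (u ∧ w) x y ≡ - (u ∧ w) y x
  ∧-antisym u w x y = antisym (u x) (u y) (w x) (w y)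
    where
    antisym : ∀ ux uy wx wy → ux * wy - wx * uy ≡ - (uy * wx - wy * ux)
    antisym = solve-∀

  ∧-neg : ∀ u w x y → ((λ z → - u z) ∧ (λ z → - w z)) x y ≡ (u ∧ w) x y
  ∧-neg u w x y = negate (u x) (u y) (w x) (w y)
    where
    negate : ∀ ux uy wx wy → - ux * - wy - - wx * - uy ≡ ux * wy - wx * uy
    negate = solve-∀

  neg-∧ : ∀ u w x y → ((λ z → - u z) ∧ w) x y ≡ (w ∧ u) x y
  neg-∧ u w x y = negate (u x) (u y) (w x) (w y)
    where
    negate : ∀ ux uy wx wy → - ux * wy - wx * - uy ≡ wx * uy - ux * wy
    negate = solve-∀

  -- The cyclic shifts τ and ρ

  module Cyclic (ν : ℕ) where

    n : ℕ
    n = suc ν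

    prev : ℕ → ℕ
    prev zero = ν
    prev (suc x) = x

    next : ℕ → ℕ
    next x = if suc x ≡ᵇ n then 0 else suc x

    prev< : ∀ {x} → x < n → prev x < n
    prev< {zero} _ = ℕ.n<1+n ν
    prev< {suc x} x<n = ℕ.m<n⇒m<1+n (ℕ.s<s⁻¹ x<n)

    next< : ∀ {x} → x < n → next x < n
    next< {x} x<n with suc x ≡ᵇ n in eq
    ... | true = ℕ.z<s
    ... | false = ℕ.≤∧≢⇒< x<n (≡ᵇ⇒≢ eq)

    prev-next : ∀ {x} → x < n → prev (next x) ≡ x
    prev-next {x} x<n with suc x ≡ᵇ n in eq
    ... | true = sym (ℕ.suc-injective (≡ᵇ⇒≡ eq))
    ... | false = refl

    infix 4 _≈_
    _≈_ : Entries → Entries → Set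
    M ≈ N = ∀ x y → x < n → y < n → M x y ≡ N x y

    has-entries-≈ : {A : Mat n} {M N : Entries} → A has-entries M → M ≈ N → A has-entries N
    has-entries-≈ A≗M M≈N a b = trans (A≗M a b) (M≈N (toℕ a) (toℕ b) (toℕ<n a) (toℕ<n b))

    ≡ᴹ-from-entries : {A B : Mat n} {M N : Entries} → A has-entries M → B has-entries N → M ≈ N → A ≡ᴹ B
    ≡ᴹ-from-entries A≗M B≗N M≈N a b = trans (has-entries-≈ A≗M M≈N a b) (sym (B≗N a b))

    τ-row : ∀ (a l : Fin n) → τ a l ≡ δ (toℕ l) (prev (toℕ a)) * ε (toℕ a)
    τ-row zero l with toℕ l ≡ᵇ ν
    ... | true = refl
    ... | false = refl
    τ-row (suc a) l = trans (δ-comm (toℕ a) (toℕ l)) (sym (ℤ.*-identityʳ _))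

    ρ-column : ∀ (l b : Fin n) → ρ l b ≡ δ (toℕ l) (next (toℕ b))
    ρ-column zero b with suc (toℕ b) ≡ᵇ n
    ... | true = refl
    ... | false = refl
    ρ-column (suc l) b with suc (toℕ b) ≡ᵇ n in eq
    ... | true = δ-≢ (ℕ.<⇒≢ (ℕ.<-≤-trans (toℕ<n (suc l)) (ℕ.≤-reflexive (sym (≡ᵇ⇒≡ eq)))) ∘ cong suc)
    ... | false = refl

    module _ {A : Mat n} {M : Entries} (A≗M : A has-entries M) where

      τ·-entries : τ · A has-entries λ x y → ε x * M (prev x) y
      τ·-entries a b = sumFin-pick (λ t → ε (toℕ a) * M t (toℕ b)) (prev< (toℕ<n a)) λ l →
        trans (cong₂ _*_ (τ-row a l) (A≗M l b)) (ℤ.*-assoc (δ (toℕ l) (prev (toℕ a))) _ _)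

      ·τ⁻¹-entries : A · τ⁻¹ has-entries λ x y → M x (prev y) * ε y
      ·τ⁻¹-entries a b = sumFin-pick (λ t → M (toℕ a) t * ε (toℕ b)) (prev< (toℕ<n b)) λ l →
        trans (cong₂ _*_ (A≗M a l) (τ-row b l)) (swap (M (toℕ a) (toℕ l)) (δ (toℕ l) (prev (toℕ b))) (ε (toℕ b)))
        where
        swap : ∀ m d e → m * (d * e) ≡ d * (m * e)
        swap = solve-∀

      ρ⁻¹·-entries : ρ⁻¹ · A has-entries λ x y → M (next x) y
      ρ⁻¹·-entries a b = sumFin-pick (λ t → M t (toℕ b)) (next< (toℕ<n a)) λ l →
        cong₂ _*_ (ρ-column l a) (A≗M l b)

      ·ρ-entries : A · ρ has-entries λ x y → M x (next y)
      ·ρ-entries a b = sumFin-pick (M (toℕ a)) (next< (toℕ<n b)) λ l →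
        trans (cong₂ _*_ (A≗M a l) (ρ-column l b)) (ℤ.*-comm (M (toℕ a) (toℕ l)) _)

    ε-conjᴱ : Entries → Entries
    ε-conjᴱ M x y = ε x * M x y * ε y

    τ-conjᴱ : Entries → Entries
    τ-conjᴱ M = ε-conjᴱ (λ x y → M (prev x) (prev y))

    τ-conj-entries : {A : Mat n} {M : Entries} → A has-entries M → (τ · A) · τ⁻¹ has-entries τ-conjᴱ M
    τ-conj-entries {M = M} A≗M = ·τ⁻¹-entries {M = λ x y → ε x * M (prev x) y} (τ·-entries {M = M} A≗M)

    ρ-conj-entries : {A : Mat n} {M : Entries} → A has-entries M →
      (ρ⁻¹ · A) · ρ has-entries λ x y → M (next x) (next y)
    ρ-conj-entries {M = M} A≗M = ·ρ-entries {M = λ x y → M (next x) y} (ρ⁻¹·-entries {M = M} A≗M)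

    ε-conjᴱ-involutive : ∀ M x y → ε-conjᴱ (ε-conjᴱ M) x y ≡ M x y
    ε-conjᴱ-involutive M x y = begin
      ε x * (ε x * M x y * ε y) * ε y     ≡⟨ regroup (ε x) (ε y) (M x y) ⟩
      ε x * ε x * M x y * (ε y * ε y)     ≡⟨ cong₂ (λ s t → s * M x y * t) (ε² x) (ε² y) ⟩
      + 1 * M x y * + 1                   ≡⟨ trans (ℤ.*-identityʳ _) (ℤ.*-identityˡ _) ⟩
      M x y                               ∎
      where
      open ≡-Reasoning
      regroup : ∀ a b m → a * (a * m * b) * b ≡ a * a * m * (b * b)
      regroup = solve-∀
      ε² : ∀ x → ε x * ε x ≡ + 1
      ε² zero = refl
      ε² (suc _) = refl

    ≈-setoid : Setoid _ _
    ≈-setoid = record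
      { Carrier = Entries
      ; _≈_ = _≈_
      ; isEquivalence = record
        { refl = λ x y _ _ → refl
        ; sym = λ M≈N x y x<n y<n → sym (M≈N x y x<n y<n)
        ; trans = λ M≈N N≈K x y x<n y<n → trans (M≈N x y x<n y<n) (N≈K x y x<n y<n) } }

    ∧-cong : {u u′ w w′ : ℕ → ℤ} → (∀ z → z < n → u z ≡ u′ z) → (∀ z → z < n → w z ≡ w′ z) → u ∧ w ≈ u′ ∧ w′
    ∧-cong u≈u′ w≈w′ x y x<n y<n =
      cong₂ _-_ (cong₂ _*_ (u≈u′ x x<n) (w≈w′ y y<n)) (cong₂ _*_ (w≈w′ x x<n) (u≈u′ y y<n))

    τ-conjᴱ-cong : {M N : Entries} → M ≈ N → τ-conjᴱ M ≈ τ-conjᴱ N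
    τ-conjᴱ-cong M≈N x y x<n y<n = cong (λ t → ε x * t * ε y) (M≈N (prev x) (prev y) (prev< x<n) (prev< y<n))

    τᵛ : (ℕ → ℤ) → ℕ → ℤ
    τᵛ u x = ε x * u (prev x)

    τ-conjᴱ-∧ : ∀ u w → τ-conjᴱ (u ∧ w) ≈ τᵛ u ∧ τᵛ w
    τ-conjᴱ-∧ u w x y _ _ = regroup (ε x) (ε y) (u (prev x)) (u (prev y)) (w (prev x)) (w (prev y))
      where
      regroup : ∀ a b ux uy wx wy → a * (ux * wy - wx * uy) * b ≡ a * ux * (b * wy) - a * wx * (b * uy)
      regroup = solve-∀

    ρ-conj-of-τ²-invariant : {M : Entries} → τ-conjᴱ (τ-conjᴱ M) ≈ M →
      (λ x y → ε-conjᴱ M (next x) (next y)) ≈ τ-conjᴱ M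
    ρ-conj-of-τ²-invariant {M} inv x y x<n y<n = begin
      ε-conjᴱ M (next x) (next y)
        ≡⟨ cong (λ t → ε (next x) * t * ε (next y)) (sym (inv (next x) (next y) (next< x<n) (next< y<n))) ⟩
      ε-conjᴱ (ε-conjᴱ (λ x y → τ-conjᴱ M (prev x) (prev y))) (next x) (next y)
        ≡⟨ ε-conjᴱ-involutive (λ x y → τ-conjᴱ M (prev x) (prev y)) (next x) (next y) ⟩
      τ-conjᴱ M (prev (next x)) (prev (next y))
        ≡⟨ cong₂ (τ-conjᴱ M) (prev-next x<n) (prev-next y<n) ⟩
      τ-conjᴱ M x y ∎
      where open ≡-Reasoning

    mutation-as-τ-conjugation : (B : Mat n) {M : Entries} → B has-entries M →
      (∀ i → + 0 ℤ.≤ B i zero) → (∀ j → B zero j ℤ.≤ + 0) → τ-conjᴱ (τ-conjᴱ M) ≈ M →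
      ρ⁻¹μρ≡τBτ⁻¹ B
    mutation-as-τ-conjugation B {M} B≗M col row inv =
      ≡ᴹ-from-entries (ρ-conj-entries {M = ε-conjᴱ M} μB≗) (τ-conj-entries {M = M} B≗M) (ρ-conj-of-τ²-invariant inv)
      where
      μB≗ : μ zero B has-entries ε-conjᴱ M
      μB≗ a b = trans (μ-at-sink B col row a b) (cong (λ t → ε (toℕ a) * t * ε (toℕ b)) (B≗M a b))

  -- The τ-orbit of R_N^{(k)}

  module Orbit (ν k : ℕ) (1≤k : 1 ≤ k) (k<n : k < suc ν) where
    open Cyclic ν

    p : ℕ
    p = n ∸ k

    p+k≡n : p ℕ.+ k ≡ n
    p+k≡n = ℕ.m∸n+n≡m (ℕ.<⇒≤ k<n)

    0<p : 0 < p
    0<p = ℕ.m<n⇒0<n∸m k<n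

    p<n : p < n
    p<n = subst (p <_) p+k≡n (ℕ.m<m+n p 1≤k)

    e : ℕ → ℕ → ℤ
    e c x = δ x c

    -- g c = τᶜ eₚ for c < n; the second term is eₚ after it has wrapped past index n - 1.
    g : ℕ → ℕ → ℤ
    g c x = δ x (p ℕ.+ c) - δ (x ℕ.+ n) (p ℕ.+ c)

    F : ℕ → Entries
    F c = g c ∧ e c

    g-zero : ∀ x → x < n → g 0 x ≡ δ x p
    g-zero x x<n = begin
      δ x (p ℕ.+ 0) - δ (x ℕ.+ n) (p ℕ.+ 0)  ≡⟨ cong (λ q → δ x q - δ (x ℕ.+ n) q) (ℕ.+-identityʳ p) ⟩
      δ x p - δ (x ℕ.+ n) p                  ≡⟨ cong (λ t → δ x p - t) (δ-≢ (ℕ.>⇒≢ (ℕ.<-≤-trans p<n (ℕ.m≤n+m n x)))) ⟩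
      δ x p - + 0                            ≡⟨ ℤ.+-identityʳ (δ x p) ⟩
      δ x p                                  ∎
      where open ≡-Reasoning

    g-at-origin : ∀ c → g c 0 ≡ - δ c k
    g-at-origin c = begin
      δ 0 (p ℕ.+ c) - δ n (p ℕ.+ c)   ≡⟨ cong₂ _-_ (δ-≢ (ℕ.<⇒≢ (ℕ.<-≤-trans 0<p (ℕ.m≤m+n p c))))
                                                   (δ-cong n≡p+c⇒c≡k c≡k⇒n≡p+c) ⟩
      + 0 - δ c k                     ≡⟨ ℤ.+-identityˡ _ ⟩
      - δ c k                         ∎
      where
      open ≡-Reasoning
      n≡p+c⇒c≡k : n ≡ p ℕ.+ c → c ≡ k
      n≡p+c⇒c≡k n≡p+c = ℕ.+-cancelˡ-≡ p c k (trans (sym n≡p+c) (sym p+k≡n))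
      c≡k⇒n≡p+c : c ≡ k → n ≡ p ℕ.+ c
      c≡k⇒n≡p+c refl = sym p+k≡n

    τᵛ-e : ∀ {c} → suc c < n → ∀ x → τᵛ (e c) x ≡ e (suc c) x
    τᵛ-e c<n zero = cong (λ t → - + 1 * t) (δ-≢ (ℕ.>⇒≢ (ℕ.s<s⁻¹ c<n)))
    τᵛ-e c<n (suc x) = ℤ.*-identityˡ _

    τᵛ-e-last : ∀ x → x < n → τᵛ (e ν) x ≡ - e 0 x
    τᵛ-e-last zero _ = cong (λ t → - + 1 * t) (δ-≡ {ν} refl)
    τᵛ-e-last (suc x) x<n = trans (ℤ.*-identityˡ _) (δ-≢ (ℕ.<⇒≢ (ℕ.s<s⁻¹ x<n)))

    τᵛ-g : ∀ {c} → suc c < n → ∀ x → τᵛ (g c) x ≡ g (suc c) x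
    τᵛ-g {c} c<n zero = begin
      - + 1 * (δ ν (p ℕ.+ c) - δ (ν ℕ.+ n) (p ℕ.+ c))  ≡⟨ cong (λ t → - + 1 * (δ ν (p ℕ.+ c) - t)) (δ-≢ (ℕ.>⇒≢ p+c<ν+n)) ⟩
      - + 1 * (δ ν (p ℕ.+ c) - + 0)                    ≡⟨ negate (δ ν (p ℕ.+ c)) ⟩
      + 0 - δ n (suc (p ℕ.+ c))                        ≡⟨ cong₂ _-_ (sym (δ-≢ (ℕ.<⇒≢ 0<p+1+c))) (cong (δ n) (sym (ℕ.+-suc p c))) ⟩
      δ 0 (p ℕ.+ suc c) - δ n (p ℕ.+ suc c)            ∎
      where
      open ≡-Reasoning
      negate : ∀ d → - + 1 * (d - + 0) ≡ + 0 - d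
      negate = solve-∀
      p+c<ν+n : p ℕ.+ c < ν ℕ.+ n
      p+c<ν+n = subst (p ℕ.+ c <_) (ℕ.+-comm n ν) (ℕ.+-mono-< p<n (ℕ.s<s⁻¹ c<n))
      0<p+1+c : 0 < p ℕ.+ suc c
      0<p+1+c = ℕ.<-≤-trans 0<p (ℕ.m≤m+n p (suc c))
    τᵛ-g {c} c<n (suc x) =
      trans (ℤ.*-identityˡ _) (cong (λ q → δ (suc x) q - δ (suc x ℕ.+ n) q) (sym (ℕ.+-suc p c)))

    τᵛ-g-last : ∀ x → x < n → τᵛ (g ν) x ≡ - g 0 x
    τᵛ-g-last zero _ = begin
      - + 1 * (δ ν (p ℕ.+ ν) - δ (ν ℕ.+ n) (p ℕ.+ ν))  ≡⟨ cong₂ (λ s t → - + 1 * (s - t)) (δ-≢ (ℕ.<⇒≢ (ℕ.m<n+m ν 0<p)))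
                                                                (δ-≢ (ℕ.>⇒≢ (subst (p ℕ.+ ν <_) (ℕ.+-comm n ν) (ℕ.+-monoˡ-< ν p<n)))) ⟩
      + 0                                              ≡⟨ cong -_ (δ-≢ (ℕ.<⇒≢ 0<p)) ⟨
      - δ 0 p                                          ≡⟨ cong -_ (g-zero 0 ℕ.z<s) ⟨
      - g 0 0                                          ∎
      where open ≡-Reasoning
    τᵛ-g-last (suc x) x<n = begin
      + 1 * (δ x (p ℕ.+ ν) - δ (x ℕ.+ n) (p ℕ.+ ν))  ≡⟨ cong₂ (λ s t → + 1 * (s - t)) (δ-≢ (ℕ.<⇒≢ x<p+ν)) (δ-cong to from) ⟩
      + 1 * (+ 0 - δ (suc x) p)                      ≡⟨ negate (δ (suc x) p) ⟩
      - δ (suc x) p                                  ≡⟨ cong -_ (g-zero (suc x) x<n) ⟨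
      - g 0 (suc x)                                  ∎
      where
      open ≡-Reasoning
      negate : ∀ d → + 1 * (+ 0 - d) ≡ - d
      negate = solve-∀
      x<p+ν : x < p ℕ.+ ν
      x<p+ν = ℕ.<-≤-trans (ℕ.s<s⁻¹ x<n) (ℕ.m≤n+m ν p)
      to : x ℕ.+ n ≡ p ℕ.+ ν → suc x ≡ p
      to eq = ℕ.+-cancelʳ-≡ ν (suc x) p (trans (sym (ℕ.+-suc x ν)) eq)
      from : suc x ≡ p → x ℕ.+ n ≡ p ℕ.+ ν
      from eq = trans (ℕ.+-suc x ν) (cong (ℕ._+ ν) eq)

    F-step : ∀ {c} → suc c < n → τ-conjᴱ (F c) ≈ F (suc c)
    F-step {c} c<n = begin
      τ-conjᴱ (g c ∧ e c)     ≈⟨ τ-conjᴱ-∧ (g c) (e c) ⟩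
      τᵛ (g c) ∧ τᵛ (e c)     ≈⟨ ∧-cong (λ x _ → τᵛ-g c<n x) (λ x _ → τᵛ-e c<n x) ⟩
      g (suc c) ∧ e (suc c)   ∎
      where open SetoidReasoning ≈-setoid

    F-last : τ-conjᴱ (F ν) ≈ F 0
    F-last = begin
      τ-conjᴱ (g ν ∧ e ν)                  ≈⟨ τ-conjᴱ-∧ (g ν) (e ν) ⟩
      τᵛ (g ν) ∧ τᵛ (e ν)                  ≈⟨ ∧-cong τᵛ-g-last τᵛ-e-last ⟩
      (λ x → - g 0 x) ∧ (λ x → - e 0 x)    ≈⟨ (λ x y _ _ → ∧-neg (g 0) (e 0) x y) ⟩
      g 0 ∧ e 0                            ∎
      where open SetoidReasoning ≈-setoid

    g-at-k : ∀ x → x < n → g k x ≡ - e 0 x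
    g-at-k x x<n = begin
      δ x (p ℕ.+ k) - δ (x ℕ.+ n) (p ℕ.+ k)   ≡⟨ cong (λ q → δ x q - δ (x ℕ.+ n) q) p+k≡n ⟩
      δ x n - δ (x ℕ.+ n) n                   ≡⟨ cong₂ _-_ (δ-≢ (ℕ.<⇒≢ x<n)) (δ-cong (ℕ.+-cancelʳ-≡ n x 0) (cong (ℕ._+ n))) ⟩
      + 0 - δ x 0                             ≡⟨ ℤ.+-identityˡ _ ⟩
      - δ x 0                                 ∎
      where open ≡-Reasoning

    g-zero-at-half : k ℕ.+ k ≡ n → ∀ x → x < n → g 0 x ≡ e k x
    g-zero-at-half k+k≡n x x<n = trans (g-zero x x<n) (cong (δ x) (ℕ.+-cancelʳ-≡ k p k (trans p+k≡n (sym k+k≡n))))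

    F-half : k ℕ.+ k ≡ n → F k ≈ F 0
    F-half k+k≡n = begin
      g k ∧ e k                ≈⟨ ∧-cong g-at-k (λ _ _ → refl) ⟩
      (λ x → - e 0 x) ∧ e k    ≈⟨ (λ x y _ _ → neg-∧ (e 0) (e k) x y) ⟩
      e k ∧ e 0                ≈⟨ ∧-cong (g-zero-at-half k+k≡n) (λ _ _ → refl) ⟨
      g 0 ∧ e 0                ∎
      where open SetoidReasoning ≈-setoid

    τ²-step : ∀ {c} → suc (suc c) < n → τ-conjᴱ (τ-conjᴱ (F c)) ≈ F (suc (suc c))
    τ²-step {c} c<n = begin
      τ-conjᴱ (τ-conjᴱ (F c))   ≈⟨ τ-conjᴱ-cong (F-step (ℕ.<-trans (ℕ.n<1+n (suc c)) c<n)) ⟩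
      τ-conjᴱ (F (suc c))       ≈⟨ F-step c<n ⟩
      F (suc (suc c))           ∎
      where open SetoidReasoning ≈-setoid

    τ²-closes-at-end : ∀ {c} → suc (suc c) ≡ n → τ-conjᴱ (τ-conjᴱ (F c)) ≈ F 0
    τ²-closes-at-end {c} 2+c≡n = begin
      τ-conjᴱ (τ-conjᴱ (F c))   ≈⟨ τ-conjᴱ-cong (F-step (ℕ.≤-reflexive 2+c≡n)) ⟩
      τ-conjᴱ (F (suc c))       ≡⟨ cong (τ-conjᴱ ∘ F) (ℕ.suc-injective 2+c≡n) ⟩
      τ-conjᴱ (F ν)             ≈⟨ F-last ⟩
      F 0                       ∎
      where open SetoidReasoning ≈-setoid

    τ²-closes-at-half : ∀ {c} → k ℕ.+ k ≡ n → suc (suc c) ≡ k → τ-conjᴱ (τ-conjᴱ (F c)) ≈ F 0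
    τ²-closes-at-half {c} k+k≡n 2+c≡k = begin
      τ-conjᴱ (τ-conjᴱ (F c))   ≈⟨ τ²-step (subst (_< n) (sym 2+c≡k) k<n) ⟩
      F (suc (suc c))           ≡⟨ cong F 2+c≡k ⟩
      F k                       ≈⟨ F-half k+k≡n ⟩
      F 0                       ∎
      where open SetoidReasoning ≈-setoid

    R-entries : R n k has-entries F 0
    R-entries = has-entries-≈ {M = e p ∧ e 0} wedge (∧-cong (λ x x<n → sym (g-zero x x<n)) (λ _ _ → refl))
      where
      wedge : R n k has-entries e p ∧ e 0
      wedge a b = trans (if-cascade _ _ exclusive) (cong₂ _-_ (⟦∧⟧ (toℕ a ≡ᵇ p) (toℕ b ≡ᵇ 0)) (⟦∧⟧ (toℕ a ≡ᵇ 0) (toℕ b ≡ᵇ p)))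
        where
        exclusive : T ((toℕ a ≡ᵇ p) Bool.∧ (toℕ b ≡ᵇ 0)) → T ((toℕ a ≡ᵇ 0) Bool.∧ (toℕ b ≡ᵇ p)) → ⊥
        exclusive a≡p∧b≡0 a≡0∧b≡p = ℕ.<⇒≢ 0<p (trans (sym a≡0) a≡p)
          where
          a≡p = ℕ.≡ᵇ⇒≡ (toℕ a) p (proj₁ (Equivalence.to T-∧ a≡p∧b≡0))
          a≡0 = ℕ.≡ᵇ⇒≡ (toℕ a) 0 (proj₁ (Equivalence.to T-∧ a≡0∧b≡p))

    τᶜ-conj-entries : ∀ c → c < n → (τ ^ᴹ c · R n k) · τ⁻¹ ^ᴹ c has-entries F c
    τᶜ-conj-entries zero _ = has-entries-≡ᴹ {M = F 0} (λ i j → trans (·-identityʳ (I · R n k) i j) (·-identityˡ (R n k) i j)) R-entries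
    τᶜ-conj-entries (suc c) c<n =
      has-entries-≡ᴹ {M = F (suc c)} (conj-^ᴹ-suc τ (R n k) τ⁻¹ c)
        (has-entries-≈ {M = τ-conjᴱ (F c)} (τ-conj-entries {M = F c} (τᶜ-conj-entries c (ℕ.<-trans (ℕ.n<1+n c) c<n))) (F-step c<n))

    F-sink : ∀ c x → x < n → + 0 ℤ.≤ F c x 0
    F-sink zero x x<n = subst (+ 0 ℤ.≤_) (sym F0x0≡δxp) (0≤δ x p)
      where
      F0x0≡δxp : F 0 x 0 ≡ δ x p
      F0x0≡δxp = begin
        g 0 x * + 1 - δ x 0 * g 0 0     ≡⟨ cong₂ (λ s t → s * + 1 - δ x 0 * t) (g-zero x x<n) (g-at-origin 0) ⟩
        δ x p * + 1 - δ x 0 * - δ 0 k   ≡⟨ cong (λ t → δ x p * + 1 - δ x 0 * - t) (δ-≢ (ℕ.<⇒≢ 1≤k)) ⟩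
        δ x p * + 1 - δ x 0 * - + 0     ≡⟨ simplify (δ x p) (δ x 0) ⟩
        δ x p                           ∎
        where
        open ≡-Reasoning
        simplify : ∀ a b → a * + 1 - b * - + 0 ≡ a
        simplify = solve-∀
    F-sink (suc c) x _ = subst (+ 0 ℤ.≤_) (sym F[1+c]x0≡) (0≤δ*δ x (suc c) (suc c) k)
      where
      F[1+c]x0≡ : F (suc c) x 0 ≡ δ x (suc c) * δ (suc c) k
      F[1+c]x0≡ = begin
        g (suc c) x * + 0 - δ x (suc c) * g (suc c) 0     ≡⟨ cong (λ t → g (suc c) x * + 0 - δ x (suc c) * t) (g-at-origin (suc c)) ⟩
        g (suc c) x * + 0 - δ x (suc c) * - δ (suc c) k   ≡⟨ simplify (g (suc c) x) (δ x (suc c)) (δ (suc c) k) ⟩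
        δ x (suc c) * δ (suc c) k                         ∎
        where
        open ≡-Reasoning
        simplify : ∀ a b d → a * + 0 - b * - d ≡ b * d
        simplify = solve-∀

    orbitSumᴱ : ℕ → Entries
    orbitSumᴱ m x y = sumTo m (λ i → F (2 ℕ.* i) x y)

    orbitSum-entries : ∀ m → 2 ℕ.* m ≤ n → orbitSum n k m has-entries orbitSumᴱ m
    orbitSum-entries m 2m≤n = sumMat-entries m {H = F ∘ (2 ℕ.*_)} λ i i<m →
      τᶜ-conj-entries (2 ℕ.* i) (ℕ.<-≤-trans (ℕ.*-monoʳ-< 2 i<m) 2m≤n)

    orbitSumᴱ-skew : ∀ m x y → orbitSumᴱ m x y ≡ - orbitSumᴱ m y x
    orbitSumᴱ-skew m x y = trans (sumTo-cong m (λ i _ → ∧-antisym (g (2 ℕ.* i)) (e (2 ℕ.* i)) x y))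
                          (sumTo-neg m (λ i → F (2 ℕ.* i) y x))

    orbitSumᴱ-sink : ∀ m x → x < n → + 0 ℤ.≤ orbitSumᴱ m x 0
    orbitSumᴱ-sink m x x<n = sumTo-nonneg m (λ i → F-sink (2 ℕ.* i) x x<n)

    orbitSumᴱ-τ²-invariant : ∀ m → 2 ℕ.* suc m ≤ n → τ-conjᴱ (τ-conjᴱ (F (2 ℕ.* m))) ≈ F 0 →
      τ-conjᴱ (τ-conjᴱ (orbitSumᴱ (suc m))) ≈ orbitSumᴱ (suc m)
    orbitSumᴱ-τ²-invariant m 2+2m≤n closing x y x<n y<n = begin
      τ-conjᴱ (τ-conjᴱ (orbitSumᴱ (suc m))) x y
        ≡⟨ cong (λ t → ε x * t * ε y) (sumTo-sandwich (ε (prev x)) (ε (prev y)) (suc m) _) ⟩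
      ε x * sumTo (suc m) (λ i → τ-conjᴱ (F (2 ℕ.* i)) (prev x) (prev y)) * ε y
        ≡⟨ sumTo-sandwich (ε x) (ε y) (suc m) _ ⟩
      sumTo m (λ i → τ-conjᴱ (τ-conjᴱ (F (2 ℕ.* i))) x y) + τ-conjᴱ (τ-conjᴱ (F (2 ℕ.* m))) x y
        ≡⟨ cong₂ _+_ (sumTo-cong m (λ i i<m → τ²-step (2+2i<n i<m) x y x<n y<n)) (closing x y x<n y<n) ⟩
      sumTo m (λ i → F (2 ℕ.+ 2 ℕ.* i) x y) + F 0 x y
        ≡⟨ ℤ.+-comm _ (F 0 x y) ⟩
      F 0 x y + sumTo m (λ i → F (2 ℕ.+ 2 ℕ.* i) x y)
        ≡⟨ cong (λ t → F 0 x y + t) (sumTo-cong m (λ i _ → cong (λ c → F c x y) (sym (ℕ.*-suc 2 i)))) ⟩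
      F 0 x y + sumTo m (λ i → F (2 ℕ.* suc i) x y)
        ≡⟨ sumTo-rotate m (λ i → F (2 ℕ.* i) x y) ⟨
      orbitSumᴱ (suc m) x y
        ∎
      where
      open ≡-Reasoning
      2+2i<n : ∀ {i} → i < m → 2 ℕ.+ 2 ℕ.* i < n
      2+2i<n i<m = ℕ.<-≤-trans (ℕ.+-monoʳ-< 2 (ℕ.*-monoʳ-< 2 i<m)) (subst (_≤ n) (ℕ.*-suc 2 m) 2+2m≤n)

    orbit-mutation : ∀ m → 2 ℕ.* suc m ≤ n → τ-conjᴱ (τ-conjᴱ (F (2 ℕ.* m))) ≈ F 0 →
      ρ⁻¹μρ≡τBτ⁻¹ (orbitSum n k (suc m))
    orbit-mutation m 2+2m≤n closing =
      mutation-as-τ-conjugation B B≗ column row (orbitSumᴱ-τ²-invariant m 2+2m≤n closing)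
      where
      B = orbitSum n k (suc m)
      B≗ : B has-entries orbitSumᴱ (suc m)
      B≗ = orbitSum-entries (suc m) 2+2m≤n
      column : ∀ i → + 0 ℤ.≤ B i zero
      column i = subst (+ 0 ℤ.≤_) (sym (B≗ i zero)) (orbitSumᴱ-sink (suc m) (toℕ i) (toℕ<n i))
      row : ∀ j → B zero j ℤ.≤ + 0
      row j = subst (ℤ._≤ + 0) (sym (trans (B≗ zero j) (orbitSumᴱ-skew (suc m) 0 (toℕ j))))
                    (ℤ.neg-mono-≤ (orbitSumᴱ-sink (suc m) (toℕ j) (toℕ<n j)))

open import Data.Nat using (ℕ; suc; _≤_; _<_; _*_)
open import Data.Nat.Divisibility using (_∣_)
open import Data.Fin using (zero)
open import Data.Product using (_×_)
open import Data.Sum using (_⊎_)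
open import Relation.Binary.PropositionalEquality using (_≡_)

open import Data.Nat using (zero; _+_; _<ᵇ_; pred; s≤s; z≤n)
open import Data.Nat.DivMod using (_/_; m*n/n≡m)
open import Data.Nat.Divisibility using (divides)
import Data.Nat.Properties as ℕ
open import Data.Bool using (false; if_then_else_)
open import Data.Bool.Properties using (T-≡)
open import Data.Product using (_,_)
open import Data.Sum using (inj₁; inj₂)
open import Function using (_∘_; Equivalence)
open import Relation.Binary.PropositionalEquality using (refl; sym; trans; cong; subst)

<ᵇ-irrefl : ∀ m → (m <ᵇ m) ≡ false
<ᵇ-irrefl zero = refl
<ᵇ-irrefl (suc m) = <ᵇ-irrefl m

half-of-multiple-of-4 : ∀ {r q} → 2 * r ≡ q * 4 → r ≡ q * 2
half-of-multiple-of-4 {r} {q} 2r≡4q =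
  ℕ.*-cancelˡ-≡ r (q * 2) 2 (trans 2r≡4q (trans (sym (ℕ.*-assoc q 2 2)) (ℕ.*-comm (q * 2) 2)))

mainTheorem4 : (s k : ℕ)
    → (1 ≤ k × k < suc s) ⊎ (k ≡ suc s × 4 ∣ 2 * suc s)
    → (ρ⁻¹ · μ zero (B1 (suc s) k)) · ρ ≡ᴹ B2 (suc s) k
mainTheorem4 s k (inj₁ (1≤k , k<r)) =
  subst (λ b → ρ⁻¹μρ≡τBτ⁻¹ (orbitSum (2 * suc s) k (if b then suc s else suc s / 2)))
    (sym (Equivalence.to T-≡ (ℕ.<⇒<ᵇ k<r)))
    (orbit-mutation s ℕ.≤-refl (τ²-closes-at-end (sym (ℕ.*-suc 2 s))))
  where open Orbit (pred (2 * suc s)) k 1≤k (ℕ.<-≤-trans k<r (ℕ.m≤m+n (suc s) _))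
-- No clause for divides 0: its equation 2 * suc s ≡ 0 * 4 is absurd.
mainTheorem4 s .(suc s) (inj₂ (refl , divides (suc h) 2r≡4q)) =
  subst (λ b → ρ⁻¹μρ≡τBτ⁻¹ (orbitSum (2 * suc s) (suc s) (if b then suc s else suc s / 2)))
    (sym (<ᵇ-irrefl s))
    (subst (ρ⁻¹μρ≡τBτ⁻¹ ∘ orbitSum (2 * suc s) (suc s)) (sym r/2≡q)
      (orbit-mutation h 2q≤n (τ²-closes-at-half r+r≡n (sym (trans r≡2q (ℕ.*-suc 2 h))))))
  where
  open Orbit (pred (2 * suc s)) (suc s) (s≤s z≤n) (ℕ.m<m+n (suc s) (s≤s z≤n))
  r≡q*2 : suc s ≡ suc h * 2
  r≡q*2 = half-of-multiple-of-4 {q = suc h} 2r≡4q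
  r/2≡q : suc s / 2 ≡ suc h
  r/2≡q = trans (cong (_/ 2) r≡q*2) (m*n/n≡m (suc h) 2)
  r≡2q : suc s ≡ 2 * suc h
  r≡2q = trans r≡q*2 (ℕ.*-comm (suc h) 2)
  2q≤n : 2 * suc h ≤ 2 * suc s
  2q≤n = subst (_≤ 2 * suc s) r≡2q (ℕ.m≤m+n (suc s) _)
  r+r≡n : suc s + suc s ≡ 2 * suc s
  r+r≡n = cong (suc s +_) (sym (ℕ.+-identityʳ (suc s)))
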